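{- For every nonzero polynomial $f\in\mathbb{Z}[x]$ with nonnegative integer coefficients and zero constant term, \[ |||f(x)|||=\deg(f(x))+f(1)-1 . \]
   Context: Let $S$ be the smallest set of formal expressions (terms built from the symbol $x$ with $+$, $\cdot$ and parentheses) such that $x\in S$ and, whenever $E\in S$, also $(E)+x\in S$ and $(E)\cdot x\in S$. Every nonzero polynomial with nonnegative integer coefficients and zero constant term is the value (as a polynomial) of exactly one expression in $S$ (the one given by Horner's scheme). The modified complexity $|||f|||$ of such a polynomial $f$ is the number of occurrences of $x$ in that unique expression of $S$ whose value is $f$. -}

module Defs where

open import Data.Nat using (ℕ; zero; suc; _+_; _<_)
open import Data.List using (List; []; _∷_)
open import Data.Nat.ListAction using (sum)
open import Relation.Binary.PropositionalEquality using (_≡_)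
open import Relation.Nullary using (¬_)
open import Data.Product using (∃; _×_)

-- Polynomials with nonnegative integer coefficients, as coefficient lists:
-- the list a₀ ∷ a₁ ∷ … represents a₀ + a₁ x + a₂ x² + …  (trailing zeros allowed).
Poly : Set
Poly = List ℕ

coeff : Poly → ℕ → ℕ
coeff []       _       = 0
coeff (a ∷ as) zero    = a
coeff (a ∷ as) (suc i) = coeff as i

evalAt1 : Poly → ℕ
evalAt1 = sum

IsNonzero : Poly → Set
IsNonzero f = ∃ λ i → ¬ (coeff f i ≡ 0)

IsDegree : Poly → ℕ → Set
IsDegree f d = (¬ (coeff f d ≡ 0)) × (∀ i → d < i → coeff f i ≡ 0)

data Expr : Set where
  X     : Expr
  _+X   : Expr → Expr
  _·X   : Expr → Expr

-- Kronecker delta at 1 (coefficient function of the polynomial x)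
δ₁ : ℕ → ℕ
δ₁ (suc zero) = 1
δ₁ _          = 0

valCoeff : Expr → ℕ → ℕ
valCoeff X       i       = δ₁ i
valCoeff (E +X)  i       = valCoeff E i + δ₁ i
valCoeff (E ·X)  zero    = 0
valCoeff (E ·X)  (suc i) = valCoeff E i

HasValue : Expr → Poly → Set
HasValue E f = ∀ i → valCoeff E i ≡ coeff f i

countX : Expr → ℕ
countX X      = 1
countX (E +X) = suc (countX E)
countX (E ·X) = suc (countX E)

{-# OPTIONS --safe #-}
-- An expression of S is x followed by a word in "+x" and "·x". Each "·x" raises the
-- degree of the value by one and each "+x" adds one to its value at 1, so an
-- expression with a "·x"s and b "+x"s has 1 + a + b occurrences of x, degree 1 + a
-- and value 1 + b at x = 1. Horner's scheme supplies an expression for every f.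
module Submission where

open import Defs
open import Data.Nat using (ℕ; zero; suc; _+_; _*_; _∸_; _≤_; _<_; s≤s; z≤n)
open import Data.Nat.Properties
  using (+-identityʳ; +-comm; +-assoc; +-suc; *-zeroʳ; *-suc; m+n≡0⇒m≡0; m+n∸n≡m;
         ≤-trans; <-cmp; m≤m+n; m≤n+m; +-0-commutativeMonoid)
open import Data.Nat.ListAction using (sum)
open import Data.Fin using (toℕ)
open import Data.List using (List; []; _∷_; length)
open import Data.Product using (Σ; _×_; _,_)
open import Data.Sum using (_⊎_; inj₁; inj₂)
open import Data.Empty using (⊥-elim)
open import Relation.Nullary using (¬_)
open import Relation.Binary using (tri<; tri≈; tri>)
open import Relation.Binary.PropositionalEquality
open import Algebra.Properties.CommutativeMonoid.Sum +-0-commutativeMonoid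
  using (∑-distrib-+; sum-cong-≗; sum-replicate-zero)
  renaming (sum to sumᶠ)

∑< : ℕ → (ℕ → ℕ) → ℕ
∑< n g = sumᶠ {n} (λ i → g (toℕ i))

∑<-cong : ∀ n {g h : ℕ → ℕ} → (∀ i → g i ≡ h i) → ∑< n g ≡ ∑< n h
∑<-cong n g≗h = sum-cong-≗ {n} (λ i → g≗h (toℕ i))

∑<-coeff : (f : Poly) → ∀ {n} → length f ≤ n → ∑< n (coeff f) ≡ sum f
∑<-coeff []       {n}     _         = sum-replicate-zero n
∑<-coeff (a ∷ as) {suc n} (s≤s len) = cong (a +_) (∑<-coeff as len)

∑<-δ₁ : ∀ {n} → 2 ≤ n → ∑< n δ₁ ≡ 1
∑<-δ₁ {suc (suc n)} _             = cong suc (sum-replicate-zero n)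
∑<-δ₁ {suc zero}    (s≤s ())

δ₁-vanishes : ∀ {i} → 1 < i → δ₁ i ≡ 0
δ₁-vanishes {suc (suc i)} _         = refl
δ₁-vanishes {suc zero}    (s≤s ())

degree : Expr → ℕ
degree X      = 1
degree (E +X) = degree E
degree (E ·X) = suc (degree E)

valueAt1 : Expr → ℕ
valueAt1 X      = 1
valueAt1 (E +X) = suc (valueAt1 E)
valueAt1 (E ·X) = valueAt1 E

countX+1≡degree+valueAt1 : ∀ E → countX E + 1 ≡ degree E + valueAt1 E
countX+1≡degree+valueAt1 X      = refl
countX+1≡degree+valueAt1 (E +X) =
  trans (cong suc (countX+1≡degree+valueAt1 E)) (sym (+-suc (degree E) (valueAt1 E)))
countX+1≡degree+valueAt1 (E ·X) = cong suc (countX+1≡degree+valueAt1 E)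

1≤degree : ∀ E → 1 ≤ degree E
1≤degree X      = s≤s z≤n
1≤degree (E +X) = 1≤degree E
1≤degree (E ·X) = s≤s z≤n

valCoeff-degree≢0 : ∀ E → ¬ valCoeff E (degree E) ≡ 0
valCoeff-degree≢0 X      ()
valCoeff-degree≢0 (E +X) eq = valCoeff-degree≢0 E (m+n≡0⇒m≡0 _ eq)
valCoeff-degree≢0 (E ·X) eq = valCoeff-degree≢0 E eq

valCoeff-vanishes : ∀ E {i} → degree E < i → valCoeff E i ≡ 0
valCoeff-vanishes X      {i}     deg<i       = δ₁-vanishes deg<i
valCoeff-vanishes (E +X) {i}     deg<i       =
  cong₂ _+_ (valCoeff-vanishes E deg<i) (δ₁-vanishes (≤-trans (s≤s (1≤degree E)) deg<i))
valCoeff-vanishes (E ·X) {suc i} (s≤s deg<i) = valCoeff-vanishes E deg<i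

∑<-valCoeff : ∀ E {n} → degree E < n → ∑< n (valCoeff E) ≡ valueAt1 E
∑<-valCoeff X      deg<n       = ∑<-δ₁ deg<n
∑<-valCoeff (E +X) {n} deg<n   = begin
  ∑< n (λ i → valCoeff E i + δ₁ i) ≡⟨ ∑-distrib-+ {n} (λ i → valCoeff E (toℕ i)) (λ i → δ₁ (toℕ i)) ⟩
  ∑< n (valCoeff E) + ∑< n δ₁      ≡⟨ cong₂ _+_ (∑<-valCoeff E deg<n)
                                                (∑<-δ₁ (≤-trans (s≤s (1≤degree E)) deg<n)) ⟩
  valueAt1 E + 1                   ≡⟨ +-comm (valueAt1 E) 1 ⟩
  suc (valueAt1 E)                 ∎
  where open ≡-Reasoning
∑<-valCoeff (E ·X) {suc n} (s≤s deg<n) = ∑<-valCoeff E deg<n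

degree-unique : ∀ E f {d} → HasValue E f → IsDegree f d → degree E ≡ d
degree-unique E f {d} E≗f (fd≢0 , above-d) with <-cmp (degree E) d
... | tri< deg<d _ _ = ⊥-elim (fd≢0 (trans (sym (E≗f d)) (valCoeff-vanishes E deg<d)))
... | tri≈ _ deg≡d _ = deg≡d
... | tri> _ _ d<deg =
  ⊥-elim (valCoeff-degree≢0 E (trans (E≗f (degree E)) (above-d (degree E) d<deg)))

valueAt1-unique : ∀ E f → HasValue E f → valueAt1 E ≡ evalAt1 f
valueAt1-unique E f E≗f = begin
  valueAt1 E          ≡⟨ sym (∑<-valCoeff E (m≤n+m (suc (degree E)) (length f))) ⟩
  ∑< n (valCoeff E)   ≡⟨ ∑<-cong n E≗f ⟩
  ∑< n (coeff f)      ≡⟨ ∑<-coeff f (m≤m+n (length f) (suc (degree E))) ⟩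
  evalAt1 f           ∎
  where
  open ≡-Reasoning
  n = length f + suc (degree E)

_+X^_ : Expr → ℕ → Expr
E +X^ zero  = E
E +X^ suc k = (E +X^ k) +X

-- δ₁ i * k rather than k * δ₁ i: it computes once i is a constructor pattern.
valCoeff-+X^ : ∀ E k i → valCoeff (E +X^ k) i ≡ valCoeff E i + δ₁ i * k
valCoeff-+X^ E zero    i = sym (trans (cong (valCoeff E i +_) (*-zeroʳ (δ₁ i))) (+-identityʳ _))
valCoeff-+X^ E (suc k) i = begin
  valCoeff (E +X^ k) i + δ₁ i       ≡⟨ cong (_+ δ₁ i) (valCoeff-+X^ E k i) ⟩
  valCoeff E i + δ₁ i * k + δ₁ i    ≡⟨ +-assoc (valCoeff E i) (δ₁ i * k) (δ₁ i) ⟩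
  valCoeff E i + (δ₁ i * k + δ₁ i)  ≡⟨ cong (valCoeff E i +_) (+-comm (δ₁ i * k) (δ₁ i)) ⟩
  valCoeff E i + (δ₁ i + δ₁ i * k)  ≡⟨ cong (valCoeff E i +_) (sym (*-suc (δ₁ i) k)) ⟩
  valCoeff E i + δ₁ i * suc k       ∎
  where open ≡-Reasoning

-- Horner: if l = a + x·l' and E has value x·l', then (E)·x followed by a copies of +x
-- has value x·l.
horner : (l : List ℕ) → (∀ i → coeff l i ≡ 0) ⊎ Σ Expr (λ E → HasValue E (0 ∷ l))
horner []       = inj₁ (λ _ → refl)
horner (a ∷ as) with horner as
horner (zero  ∷ as) | inj₁ as≗0 = inj₁ λ { zero → refl ; (suc i) → as≗0 i }
horner (suc k ∷ as) | inj₁ as≗0 = inj₂ (X +X^ k , value)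
  where
  value : HasValue (X +X^ k) (0 ∷ suc k ∷ as)
  value i rewrite valCoeff-+X^ X k i with i
  ... | zero        = refl
  ... | suc zero    = cong suc (+-identityʳ k)
  ... | suc (suc j) = sym (as≗0 j)
horner (a ∷ as) | inj₂ (E , E≗as) = inj₂ ((E ·X) +X^ a , value)
  where
  value : HasValue ((E ·X) +X^ a) (0 ∷ a ∷ as)
  value i rewrite valCoeff-+X^ (E ·X) a i with i
  ... | zero        = refl
  ... | suc zero    = cong₂ _+_ (E≗as 0) (+-identityʳ a)
  ... | suc (suc j) = trans (+-identityʳ _) (E≗as (suc j))

hornerExpr : (f : Poly) → IsNonzero f → coeff f 0 ≡ 0 → Σ Expr (λ E → HasValue E f)
hornerExpr []       (i , fi≢0) _    = ⊥-elim (fi≢0 refl)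
hornerExpr (a ∷ as) (i , fi≢0) refl with horner as
... | inj₁ as≗0 = ⊥-elim (fi≢0 (vanish i))
  where
  vanish : ∀ i → coeff (0 ∷ as) i ≡ 0
  vanish zero    = refl
  vanish (suc i) = as≗0 i
... | inj₂ E≗f  = E≗f

proposition3p11 : (f : Poly) → IsNonzero f → coeff f 0 ≡ 0 →
    (d : ℕ) → IsDegree f d →
    Σ Expr (λ E → HasValue E f)
      × ((E : Expr) → HasValue E f → countX E ≡ d + evalAt1 f ∸ 1)
proposition3p11 f f≢0 f0≡0 d deg-f = hornerExpr f f≢0 f0≡0 , count
  where
  count : (E : Expr) → HasValue E f → countX E ≡ d + evalAt1 f ∸ 1
  count E E≗f = begin
    countX E                    ≡⟨ sym (m+n∸n≡m (countX E) 1) ⟩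
    countX E + 1 ∸ 1            ≡⟨ cong (_∸ 1) (countX+1≡degree+valueAt1 E) ⟩
    degree E + valueAt1 E ∸ 1   ≡⟨ cong₂ (λ a b → a + b ∸ 1) (degree-unique E f E≗f deg-f)
                                                             (valueAt1-unique E f E≗f) ⟩
    d + evalAt1 f ∸ 1           ∎
    where open ≡-Reasoning
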